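{- For all integers $r,j,n\ge 1$, $$p^r_j(n)=p^r_{j-1}(n)+\sum_{s=0}^{n-1}\binom{n}{s}\,p^r_{j-1}(s)\,p^0_1(n-s).$$
   Context: A preferential arrangement of a finite set $S$ is an ordered set partition of $S$ (a sequence of nonempty pairwise disjoint blocks with union $S$); the empty set has exactly one. Let $a(w)$ be the number of preferential arrangements of a $w$-element set ($a(0)=1$). A barred preferential arrangement of $X_n=\{1,\dots,n\}$ with $k$ bars is a sequence of $k+1$ possibly empty, pairwise disjoint sections with union $X_n$, each equipped with a preferential arrangement of its elements. A restricted section is one whose preferential arrangement has at most one block (exactly one choice); a free section may carry any preferential arrangement. For integers $r,j\ge0$ with $r+j\ge1$, $p^r_j(n)$ is the number of barred preferential arrangements of $X_n$ with $r+j$ sections ($r+j-1$ bars) in which $r$ fixed sections are restricted and $j$ fixed sections are free; equivalently $p^r_j(n)=\sum_{w_1+\cdots+w_{r+j}=n}\frac{n!}{w_1!\cdots w_{r+j}!}\prod_{i=r+1}^{r+j}a(w_i)$ (sum over nonnegative integer solutions). In particular $p^0_1(n)=a(n)$ and $p^r_0(n)=r^n$. -}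

module Defs where

open import Data.Nat using (ℕ; zero; suc; _+_; _*_; _∸_; _≤ᵇ_)
open import Data.Nat.Combinatorics using (_C_)
open import Data.Bool using (Bool; true; false)
open import Data.List using (List; []; _∷_; _++_; replicate)

sumBelow : ℕ → (ℕ → ℕ) → ℕ
sumBelow zero    f = 0
sumBelow (suc n) f = sumBelow n f + f n

-- a(w): number of preferential arrangements (ordered set partitions) of a
-- w-element set.  Defined via the first block: choose its k ≥ 1 elements,
-- then arrange the remaining w-k elements:  a(0) = 1,
-- a(n+1) = Σ_{k=0}^{n} C(n+1, k+1) · a(n-k).
-- Course-of-values: aTable n m = a(m) for all m ≤ n.
aTable : ℕ → ℕ → ℕ
aTable zero    m = 1
aTable (suc n) m with m ≤ᵇ n
... | true  = aTable n m
... | false = sumBelow (suc n) (λ k → (suc n C suc k) * aTable n (n ∸ k))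

a : ℕ → ℕ
a n = aTable n n

-- Weight of one section of size w: restricted (false) has exactly 1
-- arrangement, free (true) has a(w).
secWeight : Bool → ℕ → ℕ
secWeight false w = 1
secWeight true  w = a w

-- Number of ways to distribute an n-element set over the given list of
-- (possibly empty) sections in order, each carrying an allowed preferential
-- arrangement:  Σ_{w₁+…+w_m = n} n!/(w₁!⋯w_m!) ∏ secWeight(kindᵢ, wᵢ).
arrangements : List Bool → ℕ → ℕ
arrangements []       zero    = 1
arrangements []       (suc n) = 0
arrangements (b ∷ bs) n =
  sumBelow (suc n) (λ w → (n C w) * secWeight b w * arrangements bs (n ∸ w))

p : ℕ → ℕ → ℕ → ℕ
p r j n = arrangements (replicate r false ++ replicate j true) n

-- Counting arrangements over a sequence of sections is the binomial (exponential)
-- convolution of the one-section counts, so concatenating section lists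
-- convolves their counts. Splitting off the last free section of p^r_j(n)
-- therefore convolves p^r_{j-1} with a = p^0_1; the term where the last
-- section is empty is p^r_{j-1}(n), the others form the sum.
-- Associativity of the convolution follows, by induction, from its Leibniz rule
-- for the shift f ↦ f ∘ suc, which is Pascal's rule in disguise.
module Submission where

open import Defs
open import Data.Nat using (ℕ; zero; suc; _+_; _*_; _∸_; _<_; z≤n)
open import Data.Nat.Properties
open import Data.Nat.Combinatorics
  using (_C_; nCk≡nC[n∸k]; nCn≡1; k>n⇒nCk≡0; nCk+nC[k+1]≡[n+1]C[k+1])
open import Data.Nat.Tactic.RingSolver using (solve-∀)
open import Data.Bool using (Bool; true; false)
open import Data.List using (List; []; _∷_; _++_; [_]; replicate)
open import Data.List.Properties using (++-assoc)
open import Algebra.Properties.CommutativeSemigroup +-commutativeSemigroup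
  using (interchange; x∙yz≈y∙xz)
open import Relation.Binary.PropositionalEquality
  using (_≡_; refl; sym; trans; cong; cong₂; module ≡-Reasoning)
open ≡-Reasoning

sumBelow-cong : ∀ n {f g : ℕ → ℕ} → (∀ s → s < n → f s ≡ g s) →
                sumBelow n f ≡ sumBelow n g
sumBelow-cong zero    f≡g = refl
sumBelow-cong (suc n) f≡g =
  cong₂ _+_ (sumBelow-cong n (λ s s<n → f≡g s (m<n⇒m<1+n s<n))) (f≡g n (n<1+n n))

sumBelow-+ : ∀ n (f g : ℕ → ℕ) →
             sumBelow n (λ s → f s + g s) ≡ sumBelow n f + sumBelow n g
sumBelow-+ zero    f g = refl
sumBelow-+ (suc n) f g =
  trans (cong (_+ (f n + g n)) (sumBelow-+ n f g))
        (interchange (sumBelow n f) (sumBelow n g) (f n) (g n))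

sumBelow-unfoldˡ : ∀ n (f : ℕ → ℕ) →
                   sumBelow (suc n) f ≡ f 0 + sumBelow n (λ s → f (suc s))
sumBelow-unfoldˡ zero    f = sym (+-identityʳ (f 0))
sumBelow-unfoldˡ (suc n) f =
  trans (cong (_+ f (suc n)) (sumBelow-unfoldˡ n f)) (+-assoc (f 0) _ _)

sumBelow-zero : ∀ n → sumBelow n (λ _ → 0) ≡ 0
sumBelow-zero zero    = refl
sumBelow-zero (suc n) = trans (+-identityʳ _) (sumBelow-zero n)

nC0≡1 : ∀ n → n C 0 ≡ 1
nC0≡1 n = trans (nCk≡nC[n∸k] {0} {n} z≤n) (nCn≡1 n)

infixl 7 _⋆_

_⋆_ : (ℕ → ℕ) → (ℕ → ℕ) → ℕ → ℕ
(f ⋆ g) n = sumBelow (suc n) (λ s → (n C s) * f s * g (n ∸ s))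

Δ : (ℕ → ℕ) → ℕ → ℕ
Δ f m = f (suc m)

⋆-congˡ : ∀ n {f f′ : ℕ → ℕ} (g : ℕ → ℕ) → (∀ m → f m ≡ f′ m) →
          (f ⋆ g) n ≡ (f′ ⋆ g) n
⋆-congˡ n g f≡f′ =
  sumBelow-cong (suc n) (λ s _ → cong (λ x → (n C s) * x * g (n ∸ s)) (f≡f′ s))

⋆-congʳ : ∀ n (f : ℕ → ℕ) {g g′ : ℕ → ℕ} → (∀ m → g m ≡ g′ m) →
          (f ⋆ g) n ≡ (f ⋆ g′) n
⋆-congʳ n f g≡g′ =
  sumBelow-cong (suc n) (λ s _ → cong (λ x → (n C s) * f s * x) (g≡g′ (n ∸ s)))

⋆-distribˡ-+ : ∀ n (f g h : ℕ → ℕ) →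
               (f ⋆ (λ m → g m + h m)) n ≡ (f ⋆ g) n + (f ⋆ h) n
⋆-distribˡ-+ n f g h = trans
  (sumBelow-cong (suc n) (λ s _ → *-distribˡ-+ ((n C s) * f s) (g (n ∸ s)) (h (n ∸ s))))
  (sumBelow-+ (suc n) _ _)

⋆-distribʳ-+ : ∀ n (f g h : ℕ → ℕ) →
               ((λ m → f m + g m) ⋆ h) n ≡ (f ⋆ h) n + (g ⋆ h) n
⋆-distribʳ-+ n f g h = trans
  (sumBelow-cong (suc n) (λ s _ → distrib (n C s) (f s) (g s) (h (n ∸ s))))
  (sumBelow-+ (suc n) _ _)
  where
  distrib : ∀ c x y z → c * (x + y) * z ≡ c * x * z + c * y * z
  distrib = solve-∀

⋆-leibniz : ∀ n (f g : ℕ → ℕ) → (f ⋆ g) (suc n) ≡ (Δ f ⋆ g) n + (f ⋆ Δ g) n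
⋆-leibniz n f g = begin
  (f ⋆ g) (suc n)
    ≡⟨ sumBelow-unfoldˡ (suc n) term ⟩
  term 0 + sumBelow (suc n) (λ s → term (suc s))
    ≡⟨ cong (term 0 +_) (trans (sumBelow-cong (suc n) (λ s _ → pascal s))
                               (sumBelow-+ (suc n) _ _)) ⟩
  term 0 + ((Δ f ⋆ g) n + sumBelow (suc n) upper)
    ≡⟨ x∙yz≈y∙xz (term 0) ((Δ f ⋆ g) n) (sumBelow (suc n) upper) ⟩
  (Δ f ⋆ g) n + (term 0 + sumBelow (suc n) upper)
    ≡⟨ cong ((Δ f ⋆ g) n +_) shifted ⟩
  (Δ f ⋆ g) n + (f ⋆ Δ g) n ∎
  where
  term : ℕ → ℕ
  term s = (suc n C s) * f s * g (suc n ∸ s)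
  upper : ℕ → ℕ
  upper s = (n C suc s) * f (suc s) * g (n ∸ s)

  pascal : ∀ s → term (suc s) ≡ (n C s) * f (suc s) * g (n ∸ s) + upper s
  pascal s = begin
    (suc n C suc s) * f (suc s) * g (n ∸ s)
      ≡⟨ cong (λ c → c * f (suc s) * g (n ∸ s)) (sym (nCk+nC[k+1]≡[n+1]C[k+1] n s)) ⟩
    (n C s + n C suc s) * f (suc s) * g (n ∸ s)
      ≡⟨ distrib (n C s) (n C suc s) (f (suc s)) (g (n ∸ s)) ⟩
    (n C s) * f (suc s) * g (n ∸ s) + upper s ∎
    where
    distrib : ∀ c d x y → (c + d) * x * y ≡ c * x * y + d * x * y
    distrib = solve-∀

  -- The last upper term vanishes (n C (n+1) = 0), and for s < n, g (n ∸ s) is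
  -- Δ g evaluated at n ∸ (s + 1).
  shifted : term 0 + sumBelow (suc n) upper ≡ (f ⋆ Δ g) n
  shifted = sym (begin
    (f ⋆ Δ g) n
      ≡⟨ sumBelow-unfoldˡ n _ ⟩
    (n C 0) * f 0 * g (suc n) + sumBelow n (λ s → (n C suc s) * f (suc s) * g (suc (n ∸ suc s)))
      ≡⟨ cong₂ _+_ (cong (λ c → c * f 0 * g (suc n)) (trans (nC0≡1 n) (sym (nC0≡1 (suc n)))))
                   (sumBelow-cong n (λ s s<n → cong (λ m → (n C suc s) * f (suc s) * g m)
                                                    (sym (+-∸-assoc 1 s<n)))) ⟩
    term 0 + sumBelow n upper
      ≡⟨ cong (term 0 +_) (sym (+-identityʳ (sumBelow n upper))) ⟩
    term 0 + (sumBelow n upper + 0)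
      ≡⟨ cong (λ c → term 0 + (sumBelow n upper + c * f (suc n) * g (n ∸ n)))
              (sym (k>n⇒nCk≡0 (n<1+n n))) ⟩
    term 0 + sumBelow (suc n) upper ∎)

⋆-assoc : ∀ n (f g h : ℕ → ℕ) → (f ⋆ (g ⋆ h)) n ≡ ((f ⋆ g) ⋆ h) n
⋆-assoc zero f g h = base (f 0) (g 0) (h 0)
  where
  base : ∀ x y z → 0 + 1 * x * (0 + 1 * y * z) ≡ 0 + 1 * (0 + 1 * x * y) * z
  base = solve-∀
⋆-assoc (suc n) f g h = begin
  (f ⋆ (g ⋆ h)) (suc n)
    ≡⟨ ⋆-leibniz n f (g ⋆ h) ⟩
  (Δ f ⋆ (g ⋆ h)) n + (f ⋆ Δ (g ⋆ h)) n
    ≡⟨ cong ((Δ f ⋆ (g ⋆ h)) n +_) (trans (⋆-congʳ n f (λ m → ⋆-leibniz m g h))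
                                          (⋆-distribˡ-+ n f (Δ g ⋆ h) (g ⋆ Δ h))) ⟩
  (Δ f ⋆ (g ⋆ h)) n + ((f ⋆ (Δ g ⋆ h)) n + (f ⋆ (g ⋆ Δ h)) n)
    ≡⟨ cong₂ _+_ (⋆-assoc n (Δ f) g h)
                 (cong₂ _+_ (⋆-assoc n f (Δ g) h) (⋆-assoc n f g (Δ h))) ⟩
  ((Δ f ⋆ g) ⋆ h) n + (((f ⋆ Δ g) ⋆ h) n + ((f ⋆ g) ⋆ Δ h) n)
    ≡⟨ sym (+-assoc (((Δ f ⋆ g) ⋆ h) n) _ _) ⟩
  ((Δ f ⋆ g) ⋆ h) n + ((f ⋆ Δ g) ⋆ h) n + ((f ⋆ g) ⋆ Δ h) n
    ≡⟨ cong (_+ ((f ⋆ g) ⋆ Δ h) n) (sym (trans (⋆-congˡ n h (λ m → ⋆-leibniz m f g))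
                                               (⋆-distribʳ-+ n (Δ f ⋆ g) (f ⋆ Δ g) h))) ⟩
  (Δ (f ⋆ g) ⋆ h) n + ((f ⋆ g) ⋆ Δ h) n
    ≡⟨ sym (⋆-leibniz n (f ⋆ g) h) ⟩
  ((f ⋆ g) ⋆ h) (suc n) ∎

⋆-identityˡ : ∀ n (g : ℕ → ℕ) → (arrangements [] ⋆ g) n ≡ g n
⋆-identityˡ n g = begin
  (arrangements [] ⋆ g) n
    ≡⟨ sumBelow-unfoldˡ n _ ⟩
  (n C 0) * 1 * g n + sumBelow n (λ s → (n C suc s) * 0 * g (n ∸ suc s))
    ≡⟨ cong₂ _+_ (cong (λ c → c * 1 * g n) (nC0≡1 n))
                 (sumBelow-cong n (λ s _ → cong (_* g (n ∸ suc s)) (*-zeroʳ (n C suc s)))) ⟩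
  1 * 1 * g n + sumBelow n (λ _ → 0)
    ≡⟨ cong₂ _+_ (+-identityʳ (g n)) (sumBelow-zero n) ⟩
  g n + 0
    ≡⟨ +-identityʳ (g n) ⟩
  g n ∎

arrangements-++ : ∀ (bs cs : List Bool) n →
                  arrangements (bs ++ cs) n ≡ (arrangements bs ⋆ arrangements cs) n
arrangements-++ []       cs n = sym (⋆-identityˡ n (arrangements cs))
arrangements-++ (b ∷ bs) cs n = begin
  (secWeight b ⋆ arrangements (bs ++ cs)) n
    ≡⟨ ⋆-congʳ n (secWeight b) (arrangements-++ bs cs) ⟩
  (secWeight b ⋆ (arrangements bs ⋆ arrangements cs)) n
    ≡⟨ ⋆-assoc n (secWeight b) (arrangements bs) (arrangements cs) ⟩
  (arrangements (b ∷ bs) ⋆ arrangements cs) n ∎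

replicate-suc-snoc : ∀ {A : Set} n (x : A) → replicate (suc n) x ≡ replicate n x ++ [ x ]
replicate-suc-snoc zero    x = refl
replicate-suc-snoc (suc n) x = cong (x ∷_) (replicate-suc-snoc n x)

theorem6 : (r j n : ℕ) →
    p (suc r) (suc j) (suc n)
      ≡ p (suc r) j (suc n)
        + sumBelow (suc n) (λ s → (suc n C s) * p (suc r) j s * p 0 1 (suc n ∸ s))
theorem6 r j n = begin
  arrangements (restricted ++ replicate (suc j) true) (suc n)
    ≡⟨ cong (λ bs → arrangements bs (suc n))
            (trans (cong (restricted ++_) (replicate-suc-snoc j true))
                   (sym (++-assoc restricted (replicate j true) [ true ]))) ⟩
  arrangements ((restricted ++ replicate j true) ++ [ true ]) (suc n)
    ≡⟨ arrangements-++ (restricted ++ replicate j true) [ true ] (suc n) ⟩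
  rest + (suc n C suc n) * p (suc r) j (suc n) * p 0 1 (n ∸ n)
    ≡⟨ cong₂ (λ c m → rest + c * p (suc r) j (suc n) * p 0 1 m) (nCn≡1 (suc n)) (n∸n≡0 n) ⟩
  rest + 1 * p (suc r) j (suc n) * 1
    ≡⟨ cong (rest +_) (trans (*-identityʳ _) (*-identityˡ _)) ⟩
  rest + p (suc r) j (suc n)
    ≡⟨ +-comm rest _ ⟩
  p (suc r) j (suc n) + rest ∎
  where
  restricted : List Bool
  restricted = replicate (suc r) false
  rest : ℕ
  rest = sumBelow (suc n) (λ s → (suc n C s) * p (suc r) j s * p 0 1 (suc n ∸ s))
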